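{- Let $P$ be a Schröder path of size $n$, let $x,z$ be integers such that the bounce path of $P$ at the point $(x,z-1)$ of $P$ has exactly one bounce point and the bounce decomposition of $P$ at $(x,z-1)$ is $P=U\mathtt{n}\cdot\mathtt{n}V\mathtt{e}\cdot\mathtt{e}W$, and set $y=x+1$. Then $$\sum_{\kappa:\,\kappa(x)<\kappa(y)}q^{\mathrm{asc}(\kappa)}x_{\kappa(1)}\cdots x_{\kappa(n)}=q\sum_{\kappa:\,\kappa(x)>\kappa(y)}q^{\mathrm{asc}(\kappa)}x_{\kappa(1)}\cdots x_{\kappa(n)},$$ where both sums range over colorings $\kappa$ of $\Gamma_P$ satisfying the indicated condition.
   Context: Steps: $\mathtt{n}=(0,1)$, $\mathtt{e}=(1,0)$, $\mathtt{d}=(1,1)$. A Schröder path of size $n$ is a lattice path from $(0,0)$ to $(n,n)$ with steps in $\{\mathtt{n},\mathtt{e},\mathtt{d}\}$ such that every east and every diagonal step is preceded by strictly more north steps than east steps; paths are words in $\{\mathtt{n},\mathtt{d},\mathtt{e}\}^*$. Bounce path of $P$ at a lattice point $(u_1,u_0)$ on $P$: move south from $(u_1,u_0)$ to $(u_1,u_1)$, then west until first reaching a point $(u_2,u_1)$ of $P$; if that point lies between two diagonal steps of $P$, continue south to $(u_2,u_2)$ and west to a point $(u_3,u_2)$ of $P$, and so on, stopping at the first point $(u_{k+1},u_k)$ incident to a north or east step of $P$. The points $(u_i,u_i)$ are the bounce points. The bounce decomposition at $(u_1,u_0)$ is the unique factorisation $P=Us_1\cdot s_2Vs_3\cdot s_4W$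 ($s_i$ single steps) where $Us_1$ is the part of $P$ from $(0,0)$ to $(u_{k+1},u_k)$ and $s_4W$ is the part from $(u_1,u_0)$ to $(n,n)$; dots are only markers. $\Gamma_P$ is the graph on $[n]$ where, for $1\le a<b\le n$, $\{a,b\}$ is a non-strict edge if the unit square $[a-1,a]\times[b-1,b]$ lies in the region between $P$ and the line $y=x$, and a strict edge if $P$ has a diagonal step from $(a-1,b-1)$ to $(a,b)$. A coloring is a map $\kappa:[n]\to\mathbb{Z}_{>0}$ with $\kappa(a)<\kappa(b)$ for each strict edge $\{a,b\}$, $a<b$; $\mathrm{asc}(\kappa)$ is the number of non-strict edges $\{a,b\}$, $a<b$, with $\kappa(a)<\kappa(b)$. -}

module Defs where

open import Level using (Level)
open import Data.Nat using (ℕ; zero; suc; _<_; _≤_; _≟_; _<?_; _≤?_)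
open import Data.Fin using (Fin; toℕ)
open import Data.Fin.Base using () renaming (zero to fzero; suc to fsuc)
open import Data.List using (List; []; _∷_; _++_; [_]; map; concatMap; foldr; allFin)
open import Data.Bool.ListAction using (any; all)
open import Data.Vec using (Vec; lookup) renaming ([] to []ᵥ; _∷_ to _∷ᵥ_)
open import Data.Bool using (Bool; true; false; _∧_; if_then_else_)
open import Data.Product using (Σ; _×_; _,_; proj₁; proj₂; ∃)
open import Data.Unit using (⊤)
open import Relation.Nullary using (¬_)
open import Relation.Nullary.Decidable using (⌊_⌋)
open import Relation.Binary.PropositionalEquality using (_≡_)
open import Data.List.Membership.Propositional using (_∈_)
open import Algebra.Bundles using (CommutativeRing)

data Step : Set where
  N E D : Step

Path : Set
Path = List Step

Point : Set
Point = ℕ × ℕ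

move : Point → Step → Point
move (a , b) N = a , suc b
move (a , b) E = suc a , b
move (a , b) D = suc a , suc b

endFrom : Point → Path → Point
endFrom p []      = p
endFrom p (s ∷ P) = endFrom (move p s) P

endpoint : Path → Point
endpoint = endFrom (0 , 0)

pointsFrom : Point → Path → List Point
pointsFrom p []      = p ∷ []
pointsFrom p (s ∷ P) = p ∷ pointsFrom (move p s) P

points : Path → List Point
points = pointsFrom (0 , 0)

stepsFrom : Point → Path → List (Point × Step)
stepsFrom p []      = []
stepsFrom p (s ∷ P) = (p , s) ∷ stepsFrom (move p s) P

steps : Path → List (Point × Step)
steps = stepsFrom (0 , 0)

-- SchCond a b P : reading P after a prefix containing a north steps and
-- b east steps, every east/diagonal step is preceded by strictly more
-- north steps than east steps.
SchCond : ℕ → ℕ → Path → Set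
SchCond a b []      = ⊤
SchCond a b (N ∷ P) = SchCond (suc a) b P
SchCond a b (E ∷ P) = b < a × SchCond a (suc b) P
SchCond a b (D ∷ P) = b < a × SchCond a b P

IsSchroder : ℕ → Path → Set
IsSchroder n P = endpoint P ≡ (n , n) × SchCond 0 0 P

-- (u2 , u1) is the first point of P reached when moving west from (u1 , u1)
WestHit : Path → ℕ → ℕ → Set
WestHit P u1 u2 =
  ((u2 , u1) ∈ points P) × (u2 ≤ u1) ×
  (∀ a → (a , u1) ∈ points P → a ≤ u1 → a ≤ u2)

BetweenDiagonals : Path → Point → Set
BetweenDiagonals P pt =
  Σ Path λ U → Σ Path λ W → (P ≡ U ++ D ∷ D ∷ W) × (endpoint (U ++ [ D ]) ≡ pt)

-- The bounce path of P at the point (u1 , u0) of P has exactly one bounce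
-- point (u1 , u1); its terminal point is (u2 , u1).
OneBounce : Path → ℕ → ℕ → ℕ → Set
OneBounce P u1 u0 u2 =
  ((u1 , u0) ∈ points P) × WestHit P u1 u2 × ¬ BetweenDiagonals P (u2 , u1)

-- P = U s1 · s2 V s3 · s4 W where U s1 runs from (0,0) to the terminal
-- point t of the bounce path and s4 W runs from the start point p to (n,n).
Decomp : Path → Point → Point →
         Path → Step → Step → Path → Step → Step → Path → Set
Decomp P t p U s1 s2 V s3 s4 W =
  (P ≡ U ++ s1 ∷ s2 ∷ V ++ s3 ∷ s4 ∷ W) ×
  (endpoint (U ++ [ s1 ]) ≡ t) ×
  (endpoint (U ++ s1 ∷ s2 ∷ V ++ [ s3 ]) ≡ p)

OneBounceDecomposition : Path → ℕ → ℕ →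
         Path → Step → Step → Path → Step → Step → Path → Set
OneBounceDecomposition P u1 u0 U s1 s2 V s3 s4 W =
  Σ ℕ λ u2 → OneBounce P u1 u0 u2 × Decomp P (u2 , u1) (u1 , u0) U s1 s2 V s3 s4 W

-- The graph Γ_P.  Vertex a ∈ [n] is represented by i : Fin n with
-- toℕ i = a - 1, so the unit square [a-1,a]×[b-1,b] has lower-left
-- corner (toℕ i , toℕ j).

isD : Step → Bool
isD D = true
isD _ = false

notN : Step → Bool
notN N = false
notN _ = true

-- strict edge {a,b}: P has a diagonal step from (a-1,b-1) to (a,b)
strictB : Path → ℕ → ℕ → Bool
strictB P i j =
  any (λ ps → isD (proj₂ ps) ∧ ⌊ proj₁ (proj₁ ps) ≟ i ⌋ ∧ ⌊ proj₂ (proj₁ ps) ≟ j ⌋)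
      (steps P)

-- non-strict edge {a,b}, a<b: the square [i,i+1]×[j,j+1] (i=a-1, j=b-1)
-- lies between P and y=x, i.e. i < j (square above the diagonal) and the
-- east/diagonal step of P leaving the line x = i starts at height ≥ j+1
-- (square below P).
nonStrictB : Path → ℕ → ℕ → Bool
nonStrictB P i j =
  ⌊ i <? j ⌋ ∧
  any (λ ps → notN (proj₂ ps) ∧ ⌊ proj₁ (proj₁ ps) ≟ i ⌋ ∧ ⌊ suc j ≤? proj₂ (proj₁ ps) ⌋)
      (steps P)

-- Colorings with colors in [m] (color c ∈ Fin m stands for toℕ c + 1).

allVecs : (m n : ℕ) → List (Vec (Fin m) n)
allVecs m zero    = []ᵥ ∷ []
allVecs m (suc n) = concatMap (λ v → map (λ c → c ∷ᵥ v) (allFin m)) (allVecs m n)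

pairs : (n : ℕ) → List (Fin n × Fin n)
pairs n = concatMap (λ i → map (λ j → i , j) (allFin n)) (allFin n)

properB : ∀ {m n} → Path → Vec (Fin m) n → Bool
properB {n = n} P κ =
  all (λ ij → if strictB P (toℕ (proj₁ ij)) (toℕ (proj₂ ij))
              then ⌊ toℕ (lookup κ (proj₁ ij)) <? toℕ (lookup κ (proj₂ ij)) ⌋
              else true)
      (pairs n)

count : ∀ {A : Set} → (A → Bool) → List A → ℕ
count p []       = 0
count p (a ∷ as) = if p a then suc (count p as) else count p as

asc : ∀ {m n} → Path → Vec (Fin m) n → ℕ
asc {n = n} P κ =
  count (λ ij → nonStrictB P (toℕ (proj₁ ij)) (toℕ (proj₂ ij)) ∧
                ⌊ toℕ (lookup κ (proj₁ ij)) <? toℕ (lookup κ (proj₂ ij)) ⌋)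
        (pairs n)

-- color (as a positive integer) of the vertex a ∈ [n] (1-based);
-- 0 if a is out of range (never used in that case)
colAt : ∀ {m n} → Vec (Fin m) n → ℕ → ℕ
colAt []ᵥ       _             = 0
colAt (c ∷ᵥ κ) zero          = 0
colAt (c ∷ᵥ κ) (suc zero)    = suc (toℕ c)
colAt (c ∷ᵥ κ) (suc (suc a)) = colAt κ (suc a)

-- Generating sums, evaluated in a commutative ring R with q ∈ R and the
-- variables x_1,...,x_m given by xs : Fin m → R (x_i = 0 for i > m).

module Gen {c ℓ : Level} (R : CommutativeRing c ℓ) where
  open CommutativeRing R

  pow : Carrier → ℕ → Carrier
  pow a zero    = 1#
  pow a (suc k) = a * pow a k

  sumR : List Carrier → Carrier
  sumR = foldr _+_ 0#

  prodR : List Carrier → Carrier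
  prodR = foldr _*_ 1#

  weight : ∀ {m n} → Path → Carrier → (Fin m → Carrier) → Vec (Fin m) n → Carrier
  weight {n = n} P q xs κ = pow q (asc P κ) * prodR (map (λ i → xs (lookup κ i)) (allFin n))

  colSum : (m n : ℕ) → Path → (Vec (Fin m) n → Bool) →
           Carrier → (Fin m → Carrier) → Carrier
  colSum m n P cond q xs =
    sumR (map (λ κ → if properB P κ ∧ cond κ then weight P q xs κ else 0#)
              (allVecs m n))

lhsSum : ∀ {c ℓ} (R : CommutativeRing c ℓ) (m n : ℕ) → Path → ℕ →
         CommutativeRing.Carrier R → (Fin m → CommutativeRing.Carrier R) →
         CommutativeRing.Carrier R
lhsSum R m n P x = Gen.colSum R m n P (λ κ → ⌊ colAt κ x <? colAt κ (suc x) ⌋)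

rhsSum : ∀ {c ℓ} (R : CommutativeRing c ℓ) (m n : ℕ) → Path → ℕ →
         CommutativeRing.Carrier R → (Fin m → CommutativeRing.Carrier R) →
         CommutativeRing.Carrier R
rhsSum R m n P x = Gen.colSum R m n P (λ κ → ⌊ colAt κ (suc x) <? colAt κ x ⌋)

module Submission where

-- Writing k = x-1 for the 0-based index of x, the decomposition pins
-- down where P meets rows and columns k, k+1: U stays left of column k
-- and below row k+1, V and W stay above row k+1, both twin columns end
-- with the east steps e · e at height h = z-1, and no diagonal step
-- touches the twin rows or columns.  Consequently the transposition of
-- k and k+1 preserves the strict edges of Γ_P and the squares below P
-- (k and k+1 are "twins", record Twins), and {x , y} is a non-strict
-- edge.  For twins, exchanging the colours of x and y is a bijection on
-- colourings preserving properness and the monomial x_κ, which turns a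
-- descent κ(y) < κ(x) into an ascent and adds exactly one non-strict
-- ascent; summing gives the identity (TwinSums.twin-identity).

open import Defs
open import Algebra.Bundles using (CommutativeMonoid; CommutativeRing)
open import Data.Bool using (Bool; true; false; _∧_; _∨_; if_then_else_)
open import Data.Bool.ListAction using (any)
open import Data.Bool.Properties using (∨-zeroʳ; ¬-not; ∧-commutativeMonoid; ∨-commutativeMonoid)
open import Data.Fin using (Fin; toℕ) renaming (zero to fzero; suc to fsuc)
open import Data.List using (List; []; _∷_; _++_; [_]; map; concatMap; foldr; allFin; tabulate)
open import Data.List.Membership.Propositional using (_∈_)
open import Data.List.Membership.Propositional.Properties using (∈-++⁺ʳ; ∈-++⁻)
open import Data.List.Properties using (map-++; map-∘; map-tabulate)
open import Data.List.Relation.Unary.Any using (here; there)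
open import Data.Nat using (ℕ; zero; suc; _≤_; _<_; _+_; _∸_; z≤n; s≤s; _≟_; _<?_; _≤?_)
import Data.Nat.Properties as ℕₚ
open import Data.Product using (Σ; _×_; _,_; proj₁; proj₂)
open import Data.Product.Relation.Binary.Pointwise.NonDependent using (Pointwise; ×-refl; ×-transitive)
open import Data.Sum using (_⊎_; inj₁; inj₂)
open import Data.Unit using (⊤; tt)
open import Data.Vec using (Vec; lookup) renaming ([] to []ᵥ; _∷_ to _∷ᵥ_)
open import Function using (_∘_)
open import Relation.Binary.Definitions using (tri<; tri≈; tri>)
open import Relation.Binary.PropositionalEquality
  using (_≡_; _≢_; refl; sym; trans; cong; cong₂; subst; subst₂; module ≡-Reasoning)
open import Relation.Nullary using (¬_; Dec; yes; no; contradiction)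
open import Relation.Nullary.Decidable using (⌊_⌋)

⌊⌋-yes : ∀ {A : Set} (a? : Dec A) → A → ⌊ a? ⌋ ≡ true
⌊⌋-yes (yes _) _ = refl
⌊⌋-yes (no ¬a) a = contradiction a ¬a

⌊⌋-no : ∀ {A : Set} (a? : Dec A) → ¬ A → ⌊ a? ⌋ ≡ false
⌊⌋-no (yes a) ¬a = contradiction a ¬a
⌊⌋-no (no _)  _  = refl

⌊⌋-cong : ∀ {A B : Set} (a? : Dec A) (b? : Dec B) → (A → B) → (B → A) → ⌊ a? ⌋ ≡ ⌊ b? ⌋
⌊⌋-cong (yes a) b? f g = sym (⌊⌋-yes b? (f a))
⌊⌋-cong (no ¬a) b? f g = sym (⌊⌋-no b? (¬a ∘ g))

any-∈ : ∀ {A : Set} (p : A → Bool) {e} l → e ∈ l → p e ≡ true → any p l ≡ true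
any-∈ p (a ∷ l) (here refl) pe = cong (_∨ any p l) pe
any-∈ p (a ∷ l) (there e∈) pe = trans (cong (p a ∨_) (any-∈ p l e∈ pe)) (∨-zeroʳ (p a))

any-none : ∀ {A : Set} (p : A → Bool) l → (∀ {e} → e ∈ l → p e ≡ false) → any p l ≡ false
any-none p []      _    = refl
any-none p (a ∷ l) none = cong₂ _∨_ (none (here refl)) (any-none p l (none ∘ there))

any-unique : ∀ {A : Set} (p : A → Bool) {e₀} l → e₀ ∈ l →
             (∀ {e} → e ∈ l → p e ≡ true → p e₀ ≡ true) → any p l ≡ p e₀
any-unique p {e₀} l e₀∈ forces with p e₀ in pe₀
... | true  = any-∈ p l e₀∈ pe₀
... | false = any-none p l (λ e∈ → ¬-not (λ pe → contradiction (forces e∈ pe) λ ()))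

swapℕ : ℕ → ℕ → ℕ
swapℕ zero    zero          = 1
swapℕ zero    (suc zero)    = 0
swapℕ zero    (suc (suc a)) = suc (suc a)
swapℕ (suc k) zero          = zero
swapℕ (suc k) (suc a)       = suc (swapℕ k a)

swapFin : ∀ {n} → ℕ → Fin n → Fin n
swapFin {suc (suc n)} zero fzero   = fsuc fzero
swapFin {suc zero}    zero fzero   = fzero
swapFin zero    (fsuc fzero)       = fzero
swapFin zero    (fsuc (fsuc i))    = fsuc (fsuc i)
swapFin (suc k) fzero              = fzero
swapFin (suc k) (fsuc i)           = fsuc (swapFin k i)

-- Exchanging the entries at positions k and k+1 of a vector
-- (vectors too short to have both positions are left unchanged).
swapVec : ∀ {A : Set} {n} → ℕ → Vec A n → Vec A n
swapVec zero    (a ∷ᵥ b ∷ᵥ v) = b ∷ᵥ a ∷ᵥ v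
swapVec (suc k) (a ∷ᵥ v)      = a ∷ᵥ swapVec k v
swapVec _       v             = v

toℕ-swapFin : ∀ {n} k (i : Fin n) → suc k < n → toℕ (swapFin k i) ≡ swapℕ k (toℕ i)
toℕ-swapFin {suc (suc n)} zero fzero _  = refl
toℕ-swapFin {suc zero} zero fzero (s≤s ())
toℕ-swapFin zero    (fsuc fzero)     _  = refl
toℕ-swapFin zero    (fsuc (fsuc i))  _  = refl
toℕ-swapFin (suc k) fzero            _  = refl
toℕ-swapFin (suc k) (fsuc i) (s≤s k<n) = cong suc (toℕ-swapFin k i k<n)

lookup-swapVec : ∀ {A : Set} {n} k (v : Vec A n) (i : Fin n) →
                 lookup (swapVec k v) i ≡ lookup v (swapFin k i)
lookup-swapVec zero    (a ∷ᵥ []ᵥ)      fzero           = refl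
lookup-swapVec zero    (a ∷ᵥ b ∷ᵥ v)   fzero           = refl
lookup-swapVec zero    (a ∷ᵥ b ∷ᵥ v)   (fsuc fzero)    = refl
lookup-swapVec zero    (a ∷ᵥ b ∷ᵥ v)   (fsuc (fsuc i)) = refl
lookup-swapVec (suc k) (a ∷ᵥ v)        fzero           = refl
lookup-swapVec (suc k) (a ∷ᵥ v)        (fsuc i)        = lookup-swapVec k v i

swapℕ-k : ∀ k → swapℕ k k ≡ suc k
swapℕ-k zero    = refl
swapℕ-k (suc k) = cong suc (swapℕ-k k)

swapℕ-suc : ∀ k → swapℕ k (suc k) ≡ k
swapℕ-suc zero    = refl
swapℕ-suc (suc k) = cong suc (swapℕ-suc k)

swapℕ-involutive : ∀ k a → swapℕ k (swapℕ k a) ≡ a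
swapℕ-involutive zero    zero          = refl
swapℕ-involutive zero    (suc zero)    = refl
swapℕ-involutive zero    (suc (suc a)) = refl
swapℕ-involutive (suc k) zero          = refl
swapℕ-involutive (suc k) (suc a)       = cong suc (swapℕ-involutive k a)

Off : ℕ → ℕ → Set
Off k a = a < k ⊎ suc (suc k) ≤ a

On : ℕ → ℕ → Set
On k a = a ≡ k ⊎ a ≡ suc k

off-or-on : ∀ k a → Off k a ⊎ On k a
off-or-on k a with ℕₚ.<-cmp a k
... | tri< a<k _ _ = inj₁ (inj₁ a<k)
... | tri≈ _ a≡k _ = inj₂ (inj₁ a≡k)
... | tri> _ _ k<a with ℕₚ.m≤n⇒m<n∨m≡n k<a
...   | inj₁ k+1<a  = inj₁ (inj₂ k+1<a)
...   | inj₂ k+1≡a  = inj₂ (inj₂ (sym k+1≡a))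

on⇒¬off : ∀ {k a} → On k a → ¬ Off k a
on⇒¬off (inj₁ refl) (inj₁ a<a)   = ℕₚ.n≮n _ a<a
on⇒¬off (inj₁ refl) (inj₂ a+2≤a) = ℕₚ.n≮n _ (ℕₚ.<-trans (ℕₚ.n<1+n _) a+2≤a)
on⇒¬off (inj₂ refl) (inj₁ a<k)   = ℕₚ.<-asym a<k (ℕₚ.n<1+n _)
on⇒¬off (inj₂ refl) (inj₂ a+1≤a) = ℕₚ.n≮n _ a+1≤a

swapℕ-on : ∀ {k a} → On k a → On k (swapℕ k a)
swapℕ-on {k} (inj₁ refl) = inj₂ (swapℕ-k k)
swapℕ-on {k} (inj₂ refl) = inj₁ (swapℕ-suc k)

swapℕ-off : ∀ k a → Off k a → swapℕ k a ≡ a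
swapℕ-off zero    (suc zero)    (inj₂ (s≤s ()))
swapℕ-off zero    (suc (suc a)) _                = refl
swapℕ-off (suc k) zero          _                = refl
swapℕ-off (suc k) (suc a)       (inj₁ (s≤s a<k)) = cong suc (swapℕ-off k a (inj₁ a<k))
swapℕ-off (suc k) (suc a)       (inj₂ (s≤s k≤a)) = cong suc (swapℕ-off k a (inj₂ k≤a))

swapℕ-≟ : ∀ k x a → Off k x → ⌊ x ≟ swapℕ k a ⌋ ≡ ⌊ x ≟ a ⌋
swapℕ-≟ k x a x-off = ⌊⌋-cong (x ≟ swapℕ k a) (x ≟ a) to from
  where
  open ≡-Reasoning
  fixed : swapℕ k x ≡ x
  fixed = swapℕ-off k x x-off
  to : x ≡ swapℕ k a → x ≡ a
  to x≡σa = begin x ≡⟨ sym fixed ⟩ swapℕ k x ≡⟨ cong (swapℕ k) x≡σa ⟩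
                  swapℕ k (swapℕ k a) ≡⟨ swapℕ-involutive k a ⟩ a ∎
  from : x ≡ a → x ≡ swapℕ k a
  from x≡a = trans (sym fixed) (cong (swapℕ k) x≡a)

-- A bound other than k+1 cannot tell k from k+1.
swap-<ˡ : ∀ k c b → b ≢ suc k → swapℕ k c < b → c < b
swap-<ˡ zero    zero          b       _   1<b       = ℕₚ.<-trans (s≤s z≤n) 1<b
swap-<ˡ zero    (suc zero)    b       b≢1 0<b       = ℕₚ.≤∧≢⇒< 0<b (b≢1 ∘ sym)
swap-<ˡ zero    (suc (suc c)) b       _   c<b       = c<b
swap-<ˡ (suc k) zero          b       _   0<b       = 0<b
swap-<ˡ (suc k) (suc c)       (suc b) b≢  (s≤s c<b) = s≤s (swap-<ˡ k c b (b≢ ∘ cong suc) c<b)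

swap-<ˡ? : ∀ k c b → b ≢ suc k → ⌊ swapℕ k c <? b ⌋ ≡ ⌊ c <? b ⌋
swap-<ˡ? k c b b≢ = ⌊⌋-cong (swapℕ k c <? b) (c <? b) (swap-<ˡ k c b b≢) from
  where
  from : c < b → swapℕ k c < b
  from c<b = swap-<ˡ k (swapℕ k c) b b≢ (subst (_< b) (sym (swapℕ-involutive k c)) c<b)

swap-< : ∀ k a b → (a , b) ≢ (k , suc k) → a < b → swapℕ k a < swapℕ k b
swap-< zero    zero          (suc zero)    ≢ _         = contradiction refl ≢
swap-< zero    zero          (suc (suc b)) _ _         = s≤s (s≤s z≤n)
swap-< zero    (suc zero)    (suc (suc b)) _ _         = s≤s z≤n
swap-< zero    (suc (suc a)) (suc (suc b)) _ a<b       = a<b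
swap-< zero    (suc zero)    (suc zero)    _ (s≤s ())
swap-< zero    (suc (suc a)) (suc zero)    _ (s≤s ())
swap-< (suc k) zero          (suc b)       _ _         = s≤s z≤n
swap-< (suc k) (suc a)       (suc b)       ≢ (s≤s a<b) =
  s≤s (swap-< k a b (λ e → ≢ (cong (λ p → suc (proj₁ p) , suc (proj₂ p)) e)) a<b)

swap-<? : ∀ k a b → (a , b) ≢ (k , suc k) → (a , b) ≢ (suc k , k) →
          ⌊ swapℕ k a <? swapℕ k b ⌋ ≡ ⌊ a <? b ⌋
swap-<? k a b ≢₁ ≢₂ = ⌊⌋-cong (swapℕ k a <? swapℕ k b) (a <? b) to (swap-< k a b ≢₁)
  where
  σσ : ∀ x → swapℕ k (swapℕ k x) ≡ x
  σσ = swapℕ-involutive k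
  to : swapℕ k a < swapℕ k b → a < b
  to σa<σb = subst₂ _<_ (σσ a) (σσ b) (swap-< k (swapℕ k a) (swapℕ k b) ≢′ σa<σb)
    where
    ≢′ : (swapℕ k a , swapℕ k b) ≢ (k , suc k)
    ≢′ e = ≢₂ (cong₂ _,_ (trans (sym (σσ a)) (trans (cong (swapℕ k ∘ proj₁) e) (swapℕ-k k)))
                         (trans (sym (σσ b)) (trans (cong (swapℕ k ∘ proj₂) e) (swapℕ-suc k))))

module ListSum {c ℓ} (M : CommutativeMonoid c ℓ) where
  open CommutativeMonoid M renaming (refl to ≈-refl; sym to ≈-sym; trans to ≈-trans)
  open import Algebra.Properties.CommutativeMonoid.Sum M using (sum; sum-syntax; ∑-comm; sum-cong-≋)
  open import Algebra.Properties.CommutativeSemigroup commutativeSemigroup using (x∙yz≈y∙xz; interchange)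
  open import Relation.Binary.Reasoning.Setoid setoid

  ∑ᴸ : List Carrier → Carrier
  ∑ᴸ = foldr _∙_ ε

  ∑ᴸ-++ : ∀ xs ys → ∑ᴸ (xs ++ ys) ≈ ∑ᴸ xs ∙ ∑ᴸ ys
  ∑ᴸ-++ []       ys = ≈-sym (identityˡ _)
  ∑ᴸ-++ (x ∷ xs) ys = ≈-trans (∙-cong ≈-refl (∑ᴸ-++ xs ys)) (≈-sym (assoc _ _ _))

  ∑ᴸ-cong : ∀ {A : Set} {f g : A → Carrier} l → (∀ {a} → a ∈ l → f a ≈ g a) →
            ∑ᴸ (map f l) ≈ ∑ᴸ (map g l)
  ∑ᴸ-cong []      f≈g = ≈-refl
  ∑ᴸ-cong (a ∷ l) f≈g = ∙-cong (f≈g (here refl)) (∑ᴸ-cong l (f≈g ∘ there))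

  ∑ᴸ-∙ : ∀ {A : Set} (f g : A → Carrier) l →
         ∑ᴸ (map (λ a → f a ∙ g a) l) ≈ ∑ᴸ (map f l) ∙ ∑ᴸ (map g l)
  ∑ᴸ-∙ f g []      = ≈-sym (identityˡ ε)
  ∑ᴸ-∙ f g (a ∷ l) = ≈-trans (∙-cong ≈-refl (∑ᴸ-∙ f g l)) (interchange _ _ _ _)

  ∑ᴸ-concatMap : ∀ {A B : Set} (g : B → Carrier) (h : A → List B) l →
                 ∑ᴸ (map g (concatMap h l)) ≈ ∑ᴸ (map (λ a → ∑ᴸ (map g (h a))) l)
  ∑ᴸ-concatMap g h []      = ≈-refl
  ∑ᴸ-concatMap g h (a ∷ l) = begin
    ∑ᴸ (map g (h a ++ concatMap h l))                ≡⟨ cong ∑ᴸ (map-++ g (h a) (concatMap h l)) ⟩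
    ∑ᴸ (map g (h a) ++ map g (concatMap h l))        ≈⟨ ∑ᴸ-++ (map g (h a)) _ ⟩
    ∑ᴸ (map g (h a)) ∙ ∑ᴸ (map g (concatMap h l))    ≈⟨ ∙-cong ≈-refl (∑ᴸ-concatMap g h l) ⟩
    ∑ᴸ (map g (h a)) ∙ ∑ᴸ (map (λ a → ∑ᴸ (map g (h a))) l) ∎

  ∑ᴸ-allFin : ∀ {n} (f : Fin n → Carrier) → ∑ᴸ (map f (allFin n)) ≡ sum f
  ∑ᴸ-allFin f = trans (cong ∑ᴸ (map-tabulate (λ i → i) f)) (∑ᴸ-tabulate f)
    where
    ∑ᴸ-tabulate : ∀ {n} (f : Fin n → Carrier) → ∑ᴸ (tabulate f) ≡ sum f
    ∑ᴸ-tabulate {zero}  f = refl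
    ∑ᴸ-tabulate {suc n} f = cong (f fzero ∙_) (∑ᴸ-tabulate (f ∘ fsuc))

  sum-swap : ∀ {n} k → suc k < n → (f : Fin n → Carrier) → sum (f ∘ swapFin k) ≈ sum f
  sum-swap {suc (suc n)} zero    _         f = x∙yz≈y∙xz _ _ _
  sum-swap {suc n}       (suc k) (s≤s k<n) f = ∙-cong ≈-refl (sum-swap k k<n (f ∘ fsuc))

  ∑ᴸ-allFin-swap : ∀ {n} k → suc k < n → (f : Fin n → Carrier) →
                   ∑ᴸ (map (f ∘ swapFin k) (allFin n)) ≈ ∑ᴸ (map f (allFin n))
  ∑ᴸ-allFin-swap k k<n f = begin
    ∑ᴸ (map (f ∘ swapFin k) (allFin _)) ≡⟨ ∑ᴸ-allFin (f ∘ swapFin k) ⟩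
    sum (f ∘ swapFin k)                 ≈⟨ sum-swap k k<n f ⟩
    sum f                               ≡⟨ sym (∑ᴸ-allFin f) ⟩
    ∑ᴸ (map f (allFin _))               ∎

  ∑ᴸ-pairs : ∀ n (G : Fin n × Fin n → Carrier) →
             ∑ᴸ (map G (pairs n)) ≈ ∑[ i < n ] ∑[ j < n ] G (i , j)
  ∑ᴸ-pairs n G = begin
    ∑ᴸ (map G (pairs n))
      ≈⟨ ∑ᴸ-concatMap G (λ i → map (i ,_) (allFin n)) (allFin n) ⟩
    ∑ᴸ (map (λ i → ∑ᴸ (map G (map (i ,_) (allFin n)))) (allFin n))
      ≡⟨ ∑ᴸ-allFin (λ i → ∑ᴸ (map G (map (i ,_) (allFin n)))) ⟩
    ∑[ i < n ] ∑ᴸ (map G (map (i ,_) (allFin n)))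
      ≈⟨ sum-cong-≋ (λ i → reflexive (trans (cong ∑ᴸ (sym (map-∘ (allFin n))))
                                             (∑ᴸ-allFin (λ j → G (i , j))))) ⟩
    ∑[ i < n ] ∑[ j < n ] G (i , j) ∎

  ∑ᴸ-pairs-swap : ∀ n k → suc k < n → (G : Fin n × Fin n → Carrier) →
    ∑ᴸ (map (λ ij → G (swapFin k (proj₁ ij) , swapFin k (proj₂ ij))) (pairs n)) ≈ ∑ᴸ (map G (pairs n))
  ∑ᴸ-pairs-swap n k k<n G = begin
    _ ≈⟨ ∑ᴸ-pairs n _ ⟩
    ∑[ i < n ] ∑[ j < n ] G (swapFin k i , swapFin k j)
      ≈⟨ sum-cong-≋ (λ i → sum-swap k k<n (λ j → G (swapFin k i , j))) ⟩
    ∑[ i < n ] ∑[ j < n ] G (swapFin k i , j)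
      ≈⟨ sum-swap k k<n (λ i → ∑[ j < n ] G (i , j)) ⟩
    ∑[ i < n ] ∑[ j < n ] G (i , j)
      ≈⟨ ≈-sym (∑ᴸ-pairs n G) ⟩
    ∑ᴸ (map G (pairs n)) ∎

  ∑ᴸ-allVecs-suc : ∀ m n (F : Vec (Fin m) (suc n) → Carrier) →
    ∑ᴸ (map F (allVecs m (suc n))) ≈ ∑ᴸ (map (λ v → ∑[ c < m ] F (c ∷ᵥ v)) (allVecs m n))
  ∑ᴸ-allVecs-suc m n F = ≈-trans (∑ᴸ-concatMap F _ (allVecs m n))
    (∑ᴸ-cong (allVecs m n) (λ {v} _ → reflexive
      (trans (cong ∑ᴸ (sym (map-∘ (allFin m)))) (∑ᴸ-allFin (λ c → F (c ∷ᵥ v))))))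

  ∑ᴸ-allVecs-swap : ∀ m n k → suc k < n → (F : Vec (Fin m) n → Carrier) →
    ∑ᴸ (map (F ∘ swapVec k) (allVecs m n)) ≈ ∑ᴸ (map F (allVecs m n))
  ∑ᴸ-allVecs-swap m (suc n) (suc k) (s≤s k<n) F = begin
    ∑ᴸ (map (F ∘ swapVec (suc k)) (allVecs m (suc n)))  ≈⟨ ∑ᴸ-allVecs-suc m n _ ⟩
    ∑ᴸ (map (H ∘ swapVec k) (allVecs m n))              ≈⟨ ∑ᴸ-allVecs-swap m n k k<n H ⟩
    ∑ᴸ (map H (allVecs m n))                            ≈⟨ ≈-sym (∑ᴸ-allVecs-suc m n F) ⟩
    ∑ᴸ (map F (allVecs m (suc n)))                      ∎
    where
    H : Vec (Fin m) n → Carrier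
    H v = ∑[ c < m ] F (c ∷ᵥ v)
  ∑ᴸ-allVecs-swap m (suc zero) zero (s≤s ()) F
  ∑ᴸ-allVecs-swap m (suc (suc n)) zero _ F = begin
    ∑ᴸ (map (F ∘ swapVec zero) (allVecs m (suc (suc n))))
      ≈⟨ ≈-trans (∑ᴸ-allVecs-suc m (suc n) _) (∑ᴸ-allVecs-suc m n _) ⟩
    ∑ᴸ (map (λ w → ∑[ b < m ] ∑[ a < m ] F (b ∷ᵥ a ∷ᵥ w)) (allVecs m n))
      ≈⟨ ∑ᴸ-cong (allVecs m n) (λ {w} _ → ∑-comm (λ b a → F (b ∷ᵥ a ∷ᵥ w))) ⟩
    ∑ᴸ (map (λ w → ∑[ a < m ] ∑[ b < m ] F (b ∷ᵥ a ∷ᵥ w)) (allVecs m n))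
      ≈⟨ ≈-sym (≈-trans (∑ᴸ-allVecs-suc m (suc n) F) (∑ᴸ-allVecs-suc m n _)) ⟩
    ∑ᴸ (map F (allVecs m (suc (suc n)))) ∎

-- Counting is summing indicators in (ℕ, +, 0); properness (all) and the
-- search over steps (any) are sums in (Bool, ∧, true) and (Bool, ∨, false).
ind : Bool → ℕ
ind true  = 1
ind false = 0

module ℕSum = ListSum ℕₚ.+-0-commutativeMonoid
module ∧Sum = ListSum ∧-commutativeMonoid
module ∨Sum = ListSum ∨-commutativeMonoid
open import Algebra.Properties.CommutativeMonoid.Sum ℕₚ.+-0-commutativeMonoid
  using (sum; sum-syntax; sum-cong-≗; sum-replicate-zero)

count-∑ : ∀ {A : Set} (p : A → Bool) l → count p l ≡ ℕSum.∑ᴸ (map (ind ∘ p) l)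
count-∑ p []      = refl
count-∑ p (a ∷ l) with p a
... | true  = cong suc (count-∑ p l)
... | false = count-∑ p l

∑-ind-≟ : ∀ n a → a < n → ∑[ j < n ] ind ⌊ toℕ j ≟ a ⌋ ≡ 1
∑-ind-≟ (suc n) zero    _         = cong suc (trans
  (sum-cong-≗ {n} (λ j → cong ind (⌊⌋-no (suc (toℕ j) ≟ 0) λ ()))) (sum-replicate-zero n))
∑-ind-≟ (suc n) (suc a) (s≤s a<n) = trans
  (sum-cong-≗ {n} (λ j → cong ind (⌊⌋-cong (suc (toℕ j) ≟ suc a) (toℕ j ≟ a) ℕₚ.suc-injective (cong suc))))
  (∑-ind-≟ n a a<n)

∑-ind-pair : ∀ n k → suc k < n →
  ∑[ i < n ] ∑[ j < n ] ind (⌊ toℕ i ≟ k ⌋ ∧ ⌊ toℕ j ≟ suc k ⌋) ≡ 1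
∑-ind-pair n k k<n = trans (sum-cong-≗ {n} row) (∑-ind-≟ n k (ℕₚ.<-trans (ℕₚ.n<1+n k) k<n))
  where
  row : ∀ i → ∑[ j < n ] ind (⌊ toℕ i ≟ k ⌋ ∧ ⌊ toℕ j ≟ suc k ⌋) ≡ ind ⌊ toℕ i ≟ k ⌋
  row i with ⌊ toℕ i ≟ k ⌋
  ... | true  = ∑-ind-≟ n (suc k) k<n
  ... | false = sum-replicate-zero n

colAt-lookup : ∀ {m n} (κ : Vec (Fin m) n) (i : Fin n) →
               colAt κ (suc (toℕ i)) ≡ suc (toℕ (lookup κ i))
colAt-lookup (c ∷ᵥ κ) fzero    = refl
colAt-lookup (c ∷ᵥ κ) (fsuc i) = colAt-lookup κ i

Descent : ∀ {m n} → ℕ → Vec (Fin m) n → Set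
Descent k κ = colAt κ (suc (suc k)) < colAt κ (suc k)

descent-lookup : ∀ {m n} k (κ : Vec (Fin m) n) → Descent k κ →
  ∀ i j → toℕ i ≡ suc k → toℕ j ≡ k → toℕ (lookup κ i) < toℕ (lookup κ j)
descent-lookup k κ κ↓ i j i≡ j≡ = ℕₚ.≤-pred (subst₂ _<_ (colour i i≡) (colour j j≡) κ↓)
  where
  colour : ∀ l {a} → toℕ l ≡ a → colAt κ (suc a) ≡ suc (toℕ (lookup κ l))
  colour l refl = colAt-lookup κ l

colAt-swapVec : ∀ {m n} k (κ : Vec (Fin m) n) → suc k < n →
                ∀ a → colAt (swapVec k κ) (suc a) ≡ colAt κ (suc (swapℕ k a))
colAt-swapVec zero    (c ∷ᵥ []ᵥ)     (s≤s ()) _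
colAt-swapVec zero    (c ∷ᵥ d ∷ᵥ κ)  _         zero          = refl
colAt-swapVec zero    (c ∷ᵥ d ∷ᵥ κ)  _         (suc zero)    = refl
colAt-swapVec zero    (c ∷ᵥ d ∷ᵥ κ)  _         (suc (suc a)) = refl
colAt-swapVec (suc k) (c ∷ᵥ κ)       _         zero          = refl
colAt-swapVec (suc k) (c ∷ᵥ κ)       (s≤s k<n) (suc a)       = colAt-swapVec k κ k<n a

diagonalFrom : ℕ → ℕ → Point × Step → Bool
diagonalFrom i j ps = isD (proj₂ ps) ∧ ⌊ proj₁ (proj₁ ps) ≟ i ⌋ ∧ ⌊ proj₂ (proj₁ ps) ≟ j ⌋

leavesAbove : ℕ → ℕ → Point × Step → Bool
leavesAbove i j ps = notN (proj₂ ps) ∧ ⌊ proj₁ (proj₁ ps) ≟ i ⌋ ∧ ⌊ suc j ≤? proj₂ (proj₁ ps) ⌋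

-- By definition a non-strict edge is a square that lies
-- below P and above the diagonal:  nonStrictB P i j = ⌊ i <? j ⌋ ∧ below P i j.
below : Path → ℕ → ℕ → Bool
below P i j = any (leavesAbove i j) (steps P)

record Twins (P : Path) (k : ℕ) : Set where
  field
    strict-swap : ∀ a b → strictB P (swapℕ k a) (swapℕ k b) ≡ strictB P a b
    below-swap  : ∀ a b → below P (swapℕ k a) (swapℕ k b) ≡ below P a b
    below-edge  : below P k (suc k) ≡ true

-- Exchanging the colours of twins x = k+1 and y = k+2 turns a proper
-- colouring with κ(y) < κ(x) into a proper colouring with κ(x) < κ(y)
-- and exactly one more ascent (the edge {x , y}); since it is a
-- bijection on colourings, the two generating sums differ by a factor q.
module TwinColouring {P : Path} {k : ℕ} (twins : Twins P k) where
  open Twins twins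

  nonStrict-swap : ∀ a b → (a , b) ≢ (k , suc k) → (a , b) ≢ (suc k , k) →
                   nonStrictB P (swapℕ k a) (swapℕ k b) ≡ nonStrictB P a b
  nonStrict-swap a b ≢₁ ≢₂ = cong₂ _∧_ (swap-<? k a b ≢₁ ≢₂) (below-swap a b)

  nonStrict-twins : nonStrictB P k (suc k) ≡ true
  nonStrict-twins = cong₂ _∧_ (⌊⌋-yes (k <? suc k) (ℕₚ.n<1+n k)) below-edge

  nonStrict-twins-reversed : nonStrictB P (suc k) k ≡ false
  nonStrict-twins-reversed =
    cong (_∧ below P (suc k) k) (⌊⌋-no (suc k <? k) (ℕₚ.<-asym (ℕₚ.n<1+n k)))

  ascent-unchanged : ∀ {a b} X → (a , b) ≢ (k , suc k) → (a , b) ≢ (suc k , k) →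
    ind (nonStrictB P a b ∧ X) ≡ ind (nonStrictB P (swapℕ k a) (swapℕ k b) ∧ X) + 0
  ascent-unchanged X ≢₁ ≢₂ =
    sym (trans (ℕₚ.+-identityʳ _) (cong (λ e → ind (e ∧ X)) (nonStrict-swap _ _ ≢₁ ≢₂)))

  -- The ascent indicator of the edge {a , b} for κ ∘ σ is that of
  -- {σa , σb} for κ, plus one at the twin edge (k , k+1); here X stands
  -- for the comparison of the colours κ(σa) < κ(σb).
  ascent-swap : ∀ a b X → (a ≡ k → b ≡ suc k → X ≡ true) → (a ≡ suc k → b ≡ k → X ≡ false) →
    ind (nonStrictB P a b ∧ X) ≡
    ind (nonStrictB P (swapℕ k a) (swapℕ k b) ∧ X) + ind (⌊ a ≟ k ⌋ ∧ ⌊ b ≟ suc k ⌋)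
  ascent-swap a b X up down with a ≟ k | b ≟ suc k
  ... | yes refl | yes refl
    rewrite swapℕ-k a | swapℕ-suc a | nonStrict-twins | nonStrict-twins-reversed | up refl refl = refl
  ... | yes refl | no b≢ = ascent-unchanged X (b≢ ∘ cong proj₂) (ℕₚ.<⇒≢ (ℕₚ.n<1+n a) ∘ cong proj₁)
  ... | no a≢ | _ with a ≟ suc k | b ≟ k
  ...   | yes refl | yes refl
    rewrite swapℕ-suc b | swapℕ-k b | nonStrict-twins | nonStrict-twins-reversed | down refl refl = refl
  ...   | yes refl | no b≢ = ascent-unchanged X (a≢ ∘ cong proj₁) (b≢ ∘ cong proj₂)
  ...   | no a≢′   | _     = ascent-unchanged X (a≢ ∘ cong proj₁) (a≢′ ∘ cong proj₁)

  module _ {m n : ℕ} (k<n : suc k < n) where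

    respects : Vec (Fin m) n → Fin n × Fin n → Bool
    respects κ (i , j) =
      if strictB P (toℕ i) (toℕ j) then ⌊ toℕ (lookup κ i) <? toℕ (lookup κ j) ⌋ else true

    ascent : Vec (Fin m) n → Fin n × Fin n → Bool
    ascent κ (i , j) = nonStrictB P (toℕ i) (toℕ j) ∧ ⌊ toℕ (lookup κ i) <? toℕ (lookup κ j) ⌋

    swapPair : Fin n × Fin n → Fin n × Fin n
    swapPair (i , j) = swapFin k i , swapFin k j

    isTwinEdge : Fin n × Fin n → Bool
    isTwinEdge (i , j) = ⌊ toℕ i ≟ k ⌋ ∧ ⌊ toℕ j ≟ suc k ⌋

    properB-swap : (κ : Vec (Fin m) n) → properB P (swapVec k κ) ≡ properB P κ
    properB-swap κ = trans (∧Sum.∑ᴸ-cong (pairs n) (λ {ij} _ → respects-swap ij))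
                           (∧Sum.∑ᴸ-pairs-swap n k k<n (respects κ))
      where
      respects-swap : ∀ ij → respects (swapVec k κ) ij ≡ respects κ (swapPair ij)
      respects-swap (i , j)
        rewrite lookup-swapVec k κ i | lookup-swapVec k κ j
              | toℕ-swapFin k i k<n | toℕ-swapFin k j k<n | strict-swap (toℕ i) (toℕ j) = refl

    asc-swap : (κ : Vec (Fin m) n) → Descent k κ → asc P (swapVec k κ) ≡ suc (asc P κ)
    asc-swap κ κ↓ = begin
      asc P (swapVec k κ)
        ≡⟨ count-∑ (ascent (swapVec k κ)) (pairs n) ⟩
      ∑ᴸ (map (ind ∘ ascent (swapVec k κ)) (pairs n))
        ≡⟨ ℕSum.∑ᴸ-cong (pairs n) (λ {ij} _ → ascent-swap-at ij) ⟩
      ∑ᴸ (map (λ ij → ind (ascent κ (swapPair ij)) + ind (isTwinEdge ij)) (pairs n))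
        ≡⟨ ℕSum.∑ᴸ-∙ (ind ∘ ascent κ ∘ swapPair) (ind ∘ isTwinEdge) (pairs n) ⟩
      ∑ᴸ (map (ind ∘ ascent κ ∘ swapPair) (pairs n)) + ∑ᴸ (map (ind ∘ isTwinEdge) (pairs n))
        ≡⟨ cong₂ _+_ (ℕSum.∑ᴸ-pairs-swap n k k<n (ind ∘ ascent κ))
                     (trans (ℕSum.∑ᴸ-pairs n (ind ∘ isTwinEdge)) (∑-ind-pair n k k<n)) ⟩
      ∑ᴸ (map (ind ∘ ascent κ) (pairs n)) + 1
        ≡⟨ cong (_+ 1) (sym (count-∑ (ascent κ) (pairs n))) ⟩
      asc P κ + 1
        ≡⟨ ℕₚ.+-comm (asc P κ) 1 ⟩
      suc (asc P κ) ∎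
      where
      open ≡-Reasoning
      open ℕSum using (∑ᴸ)
      ascent-swap-at : ∀ ij → ind (ascent (swapVec k κ) ij) ≡ ind (ascent κ (swapPair ij)) + ind (isTwinEdge ij)
      ascent-swap-at (i , j)
        rewrite lookup-swapVec k κ i | lookup-swapVec k κ j | toℕ-swapFin k i k<n | toℕ-swapFin k j k<n
        = ascent-swap (toℕ i) (toℕ j) X up down
        where
        X : Bool
        X = ⌊ toℕ (lookup κ (swapFin k i)) <? toℕ (lookup κ (swapFin k j)) ⌋
        σ-at : ∀ l {a} → toℕ l ≡ a → toℕ (swapFin k l) ≡ swapℕ k a
        σ-at l refl = toℕ-swapFin k l k<n
        up : toℕ i ≡ k → toℕ j ≡ suc k → X ≡ true
        up i≡ j≡ = ⌊⌋-yes (_ <? _) (descent-lookup k κ κ↓ (swapFin k i) (swapFin k j)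
          (trans (σ-at i i≡) (swapℕ-k k)) (trans (σ-at j j≡) (swapℕ-suc k)))
        down : toℕ i ≡ suc k → toℕ j ≡ k → X ≡ false
        down i≡ j≡ = ⌊⌋-no (_ <? _) (ℕₚ.<-asym (descent-lookup k κ κ↓ (swapFin k j) (swapFin k i)
          (trans (σ-at j j≡) (swapℕ-k k)) (trans (σ-at i i≡) (swapℕ-suc k))))

module TwinSums {c ℓ} (R : CommutativeRing c ℓ) where
  open CommutativeRing R renaming (refl to ≈-refl; sym to ≈-sym; trans to ≈-trans)
  open Gen R
  module +Sum = ListSum +-commutativeMonoid
  module *Sum = ListSum *-commutativeMonoid
  open import Relation.Binary.Reasoning.Setoid setoid

  sumR-scale : ∀ {A : Set} q (f : A → Carrier) l → sumR (map (λ a → q * f a) l) ≈ q * sumR (map f l)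
  sumR-scale q f []      = ≈-sym (zeroʳ q)
  sumR-scale q f (a ∷ l) = ≈-trans (+-cong ≈-refl (sumR-scale q f l)) (≈-sym (distribˡ q (f a) _))

  module _ {P : Path} {k : ℕ} (twins : Twins P k) {n : ℕ} (k<n : suc k < n) {m : ℕ}
           (q : Carrier) (xs : Fin m → Carrier) where
    open TwinColouring twins

    monomial-swap : (κ : Vec (Fin m) n) →
      prodR (map (xs ∘ lookup (swapVec k κ)) (allFin n)) ≈ prodR (map (xs ∘ lookup κ) (allFin n))
    monomial-swap κ = begin
      prodR (map (xs ∘ lookup (swapVec k κ)) (allFin n))
        ≈⟨ *Sum.∑ᴸ-cong (allFin n) (λ {i} _ → reflexive (cong xs (lookup-swapVec k κ i))) ⟩
      prodR (map (xs ∘ lookup κ ∘ swapFin k) (allFin n))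
        ≈⟨ *Sum.∑ᴸ-allFin-swap k k<n (xs ∘ lookup κ) ⟩
      prodR (map (xs ∘ lookup κ) (allFin n)) ∎

    weight-swap : (κ : Vec (Fin m) n) → Descent k κ →
                  weight P q xs (swapVec k κ) ≈ q * weight P q xs κ
    weight-swap κ κ↓ rewrite asc-swap k<n κ κ↓ =
      ≈-trans (*-assoc q _ _) (*-cong ≈-refl (*-cong ≈-refl (monomial-swap κ)))

    ascending descending : Vec (Fin m) n → Carrier
    ascending κ =
      if properB P κ ∧ ⌊ colAt κ (suc k) <? colAt κ (suc (suc k)) ⌋ then weight P q xs κ else 0#
    descending κ =
      if properB P κ ∧ ⌊ colAt κ (suc (suc k)) <? colAt κ (suc k) ⌋ then weight P q xs κ else 0#

    ascending-swap : (κ : Vec (Fin m) n) → ascending (swapVec k κ) ≈ q * descending κ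
    ascending-swap κ
      rewrite properB-swap k<n κ | colAt-swapVec k κ k<n k | colAt-swapVec k κ k<n (suc k)
            | swapℕ-k k | swapℕ-suc k
      with properB P κ | colAt κ (suc (suc k)) <? colAt κ (suc k)
    ... | true  | yes κ↓ = weight-swap κ κ↓
    ... | true  | no _   = ≈-sym (zeroʳ q)
    ... | false | _      = ≈-sym (zeroʳ q)

    -- The identity of Lemma 4.3 holds for any twin vertices x = k+1, y = k+2:
    -- recolouring by the exchange is a bijection taking the summands of
    -- the left side to q times those of the right side.
    twin-identity : lhsSum R m n P (suc k) q xs ≈ q * rhsSum R m n P (suc k) q xs
    twin-identity = begin
      sumR (map ascending (allVecs m n))                ≈⟨ ≈-sym (+Sum.∑ᴸ-allVecs-swap m n k k<n ascending) ⟩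
      sumR (map (ascending ∘ swapVec k) (allVecs m n))  ≈⟨ +Sum.∑ᴸ-cong (allVecs m n) (λ {κ} _ → ascending-swap κ) ⟩
      sumR (map (λ κ → q * descending κ) (allVecs m n)) ≈⟨ sumR-scale q descending (allVecs m n) ⟩
      q * sumR (map descending (allVecs m n))           ∎

-- How a step sits relative to the twin rows and columns k, k+1 of a
-- path whose columns k and k+1 both end with an east step at height h:
-- no east step starts at height k+1, east steps in the twin columns are
-- at height h, and diagonal steps avoid the twin rows and columns.
StepShape : ℕ → ℕ → Point × Step → Set
StepShape k h ((a , b) , N) = ⊤
StepShape k h ((a , b) , E) = b ≢ suc k × (On k a → b ≡ h)
StepShape k h ((a , b) , D) = Off k a × Off k b

module TwinShape (P : Path) (k h : ℕ)
  (shape    : ∀ {e} → e ∈ steps P → StepShape k h e)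
  (twin-end : ∀ {a} → On k a → ((a , h) , E) ∈ steps P)
  (k+2≤h    : suc (suc k) ≤ h) where

  -- Diagonal steps avoid the twins, so strict edges ignore the exchange.
  strict-swap : ∀ a b → strictB P (swapℕ k a) (swapℕ k b) ≡ strictB P a b
  strict-swap a b = ∨Sum.∑ᴸ-cong (steps P) at
    where
    at : ∀ {e} → e ∈ steps P → diagonalFrom (swapℕ k a) (swapℕ k b) e ≡ diagonalFrom a b e
    at {(_ , N)}       _  = refl
    at {(_ , E)}       _  = refl
    at {((a′ , b′) , D)} e∈ with shape e∈
    ... | a′-off , b′-off = cong₂ _∧_ (swapℕ-≟ k a′ a a′-off) (swapℕ-≟ k b′ b b′-off)

  -- Rows k and k+1 are alike: no east or diagonal step starts between them.
  below-swap-row : ∀ a b → below P a (swapℕ k b) ≡ below P a b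
  below-swap-row a b = ∨Sum.∑ᴸ-cong (steps P) at
    where
    at : ∀ {e} → e ∈ steps P → leavesAbove a (swapℕ k b) e ≡ leavesAbove a b e
    at {(_ , N)}       _  = refl
    at {((a′ , b′) , E)} e∈ = cong (⌊ a′ ≟ a ⌋ ∧_) (swap-<ˡ? k b b′ (proj₁ (shape e∈)))
    at {((a′ , b′) , D)} e∈ =
      cong (⌊ a′ ≟ a ⌋ ∧_) (swap-<ˡ? k b b′ (λ b′≡ → on⇒¬off (inj₂ b′≡) (proj₂ (shape e∈))))

  -- Columns k and k+1 are alike: both leave the diagonal region at height h.
  below-twin-column : ∀ a b → On k a → below P a b ≡ ⌊ suc b ≤? h ⌋
  below-twin-column a b a-on =
    trans (any-unique _ (steps P) (twin-end a-on) forces) (cong (_∧ ⌊ suc b ≤? h ⌋) (⌊⌋-yes (a ≟ a) refl))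
    where
    forces : ∀ {e} → e ∈ steps P → leavesAbove a b e ≡ true → leavesAbove a b ((a , h) , E) ≡ true
    forces {(_ , N)} _ ()
    forces {((a′ , b′) , E)} e∈ hit with a′ ≟ a | shape e∈
    ... | yes refl | _ , at-h rewrite sym (at-h a-on) | ⌊⌋-yes (a′ ≟ a′) refl = hit
    forces {((a′ , b′) , E)} e∈ () | no _ | _
    forces {((a′ , b′) , D)} e∈ hit with a′ ≟ a | shape e∈
    ... | yes refl | a′-off , _ = contradiction a′-off (on⇒¬off a-on)
    forces {((a′ , b′) , D)} e∈ () | no _ | _

  below-swap-column : ∀ a b → below P (swapℕ k a) b ≡ below P a b
  below-swap-column a b with off-or-on k a
  ... | inj₁ a-off rewrite swapℕ-off k a a-off = refl
  ... | inj₂ a-on  = trans (below-twin-column (swapℕ k a) b (swapℕ-on a-on))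
                           (sym (below-twin-column a b a-on))

  twins : Twins P k
  twins = record
    { strict-swap = strict-swap
    ; below-swap  = λ a b → trans (below-swap-column a (swapℕ k b)) (below-swap-row a b)
    ; below-edge  = trans (below-twin-column k (suc k) (inj₁ refl)) (⌊⌋-yes (_ ≤? h) k+2≤h)
    }

_≼_ : Point → Point → Set
_≼_ = Pointwise _≤_ _≤_

≼-refl : ∀ {p} → p ≼ p
≼-refl = ×-refl {R = _≤_} {S = _≤_} ℕₚ.≤-refl ℕₚ.≤-refl

≼-trans : ∀ {p q r} → p ≼ q → q ≼ r → p ≼ r
≼-trans = ×-transitive {R = _≤_} {S = _≤_} ℕₚ.≤-trans ℕₚ.≤-trans

move-≼ : ∀ p s → p ≼ move p s
move-≼ (a , b) N = ℕₚ.≤-refl   , ℕₚ.n≤1+n b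
move-≼ (a , b) E = ℕₚ.n≤1+n a , ℕₚ.≤-refl
move-≼ (a , b) D = ℕₚ.n≤1+n a , ℕₚ.n≤1+n b

endFrom-≼ : ∀ p A → p ≼ endFrom p A
endFrom-≼ p []      = ≼-refl
endFrom-≼ p (s ∷ A) = ≼-trans (move-≼ p s) (endFrom-≼ (move p s) A)

endFrom-++ : ∀ p A B → endFrom p (A ++ B) ≡ endFrom (endFrom p A) B
endFrom-++ p []      B = refl
endFrom-++ p (s ∷ A) B = endFrom-++ (move p s) A B

stepsFrom-++ : ∀ p A B → stepsFrom p (A ++ B) ≡ stepsFrom p A ++ stepsFrom (endFrom p A) B
stepsFrom-++ p []      B = refl
stepsFrom-++ p (s ∷ A) B = cong ((p , s) ∷_) (stepsFrom-++ (move p s) A B)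

stepsFrom-≼ : ∀ p A {e} → e ∈ stepsFrom p A →
              p ≼ proj₁ e × move (proj₁ e) (proj₂ e) ≼ endFrom p A
stepsFrom-≼ p (s ∷ A) (here refl) = ≼-refl , endFrom-≼ (move p s) A
stepsFrom-≼ p (s ∷ A) (there e∈)  with stepsFrom-≼ (move p s) A e∈
... | after-p , before-end = ≼-trans (move-≼ p s) after-p , before-end

-- Steps before the first north step of the bounce: left of column k, below row k+1.
shape-U : ∀ {k h u₂ a b} s → u₂ ≤ k → move (a , b) s ≼ (u₂ , k) → StepShape k h ((a , b) , s)
shape-U N _    _                 = tt
shape-U E u₂≤k (a+1≤u₂ , b≤k)    =
  ℕₚ.<⇒≢ (s≤s b≤k) , λ a-on → contradiction (inj₁ (ℕₚ.≤-trans a+1≤u₂ u₂≤k)) (on⇒¬off a-on)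
shape-U D u₂≤k (a+1≤u₂ , b+1≤k)  = inj₁ (ℕₚ.≤-trans a+1≤u₂ u₂≤k) , inj₁ b+1≤k

-- Steps of V: left of column k, above row k+1.
shape-V : ∀ {k h u₂ a b} s → (u₂ , suc (suc k)) ≼ (a , b) → move (a , b) s ≼ (k , h) →
          StepShape k h ((a , b) , s)
shape-V N _            _          = tt
shape-V E (_ , k+2≤b)  (a+1≤k , _) =
  ℕₚ.>⇒≢ k+2≤b , λ a-on → contradiction (inj₁ a+1≤k) (on⇒¬off a-on)
shape-V D (_ , k+2≤b)  (a+1≤k , _) = inj₁ a+1≤k , inj₂ k+2≤b

-- Steps of W: right of column k+1, above row k+1.
shape-W : ∀ {k h a b} s → suc (suc k) ≤ h → (suc (suc k) , h) ≼ (a , b) → StepShape k h ((a , b) , s)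
shape-W N _     _              = tt
shape-W E k+2≤h (k+2≤a , h≤b)  =
  ℕₚ.>⇒≢ (ℕₚ.≤-trans k+2≤h h≤b) , λ a-on → contradiction (inj₂ k+2≤a) (on⇒¬off a-on)
shape-W D k+2≤h (k+2≤a , h≤b)  = inj₂ k+2≤a , inj₂ (ℕₚ.≤-trans k+2≤h h≤b)

module TwinDecomposition (U V W : Path) {u₂ k h : ℕ}
  (U-end : endpoint U ≡ (u₂ , k)) (V-end : endFrom (u₂ , suc (suc k)) V ≡ (k , h)) where

  P : Path
  P = U ++ N ∷ N ∷ V ++ E ∷ E ∷ W

  V-box : (u₂ , suc (suc k)) ≼ (k , h)
  V-box = subst ((u₂ , suc (suc k)) ≼_) V-end (endFrom-≼ _ V)

  W-start : Point
  W-start = suc (suc k) , h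

  steps-P : steps P ≡ stepsFrom (0 , 0) U ++ ((u₂ , k) , N) ∷ ((u₂ , suc k) , N) ∷
                      stepsFrom (u₂ , suc (suc k)) V ++ ((k , h) , E) ∷ ((suc k , h) , E) ∷
                      stepsFrom W-start W
  steps-P rewrite stepsFrom-++ (0 , 0) U (N ∷ N ∷ V ++ E ∷ E ∷ W) | U-end
                | stepsFrom-++ (u₂ , suc (suc k)) V (E ∷ E ∷ W) | V-end = refl

  endpoint-P : endpoint P ≡ endFrom W-start W
  endpoint-P rewrite endFrom-++ (0 , 0) U (N ∷ N ∷ V ++ E ∷ E ∷ W) | U-end
                   | endFrom-++ (u₂ , suc (suc k)) V (E ∷ E ∷ W) | V-end = refl

  shape : ∀ {e} → e ∈ steps P → StepShape k h e
  shape {(a , b) , s} e∈ with ∈-++⁻ (stepsFrom (0 , 0) U) (subst (_ ∈_) steps-P e∈)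
  ... | inj₁ e∈U = shape-U s (proj₁ V-box) (subst (_ ≼_) U-end (proj₂ (stepsFrom-≼ _ U e∈U)))
  ... | inj₂ (here refl)         = tt
  ... | inj₂ (there (here refl)) = tt
  ... | inj₂ (there (there e∈VW)) with ∈-++⁻ (stepsFrom (u₂ , suc (suc k)) V) e∈VW
  ...   | inj₁ e∈V = shape-V s (proj₁ (stepsFrom-≼ _ V e∈V))
                               (subst (_ ≼_) V-end (proj₂ (stepsFrom-≼ _ V e∈V)))
  ...   | inj₂ (here refl)         = ℕₚ.>⇒≢ (proj₂ V-box) , λ _ → refl
  ...   | inj₂ (there (here refl)) = ℕₚ.>⇒≢ (proj₂ V-box) , λ _ → refl
  ...   | inj₂ (there (there e∈W)) = shape-W s (proj₂ V-box) (proj₁ (stepsFrom-≼ _ W e∈W))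

  twin-end : ∀ {a} → On k a → ((a , h) , E) ∈ steps P
  twin-end a-on = subst (_ ∈_) (sym steps-P) (∈-++⁺ʳ (stepsFrom (0 , 0) U) (there (there
    (∈-++⁺ʳ (stepsFrom (u₂ , suc (suc k)) V) (twin-step a-on)))))
    where
    twin-step : ∀ {a} → On k a → ((a , h) , E) ∈ ((k , h) , E) ∷ ((suc k , h) , E) ∷ stepsFrom W-start W
    twin-step (inj₁ refl) = here refl
    twin-step (inj₂ refl) = there (here refl)

  twins : Twins P k
  twins = TwinShape.twins P k h shape twin-end (proj₂ V-box)

  twins-in-range : suc (suc k) ≤ proj₁ (endpoint P)
  twins-in-range = proj₁ (subst (W-start ≼_) (sym endpoint-P) (endFrom-≼ W-start W))

north-into : ∀ {p a b} → move p N ≡ (a , b) → Σ ℕ λ k → b ≡ suc k × p ≡ (a , k)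
north-into {a , b} refl = b , refl , refl

east-into : ∀ {p a b} → move p E ≡ (suc a , b) → p ≡ (a , b)
east-into {a , b} refl = refl

decomposition-twins : ∀ {P U V W u₂ x h} → Decomp P (u₂ , x) (x , h) U N N V E E W →
  Σ ℕ λ k → x ≡ suc k × Twins P k × suc (suc k) ≤ proj₁ (endpoint P)
decomposition-twins {U = U} {V} {W} {u₂} {h = h} (refl , UN-end , UNNVE-end)
  with north-into (trans (sym (endFrom-++ (0 , 0) U [ N ])) UN-end)
... | k , refl , U-end = k , refl , twins , twins-in-range
  where
  V-end : endFrom (u₂ , suc (suc k)) V ≡ (k , h)
  V-end = east-into (begin
    move (endFrom (u₂ , suc (suc k)) V) E       ≡⟨ sym (endFrom-++ (u₂ , suc (suc k)) V [ E ]) ⟩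
    endFrom (u₂ , k) (N ∷ N ∷ V ++ [ E ])       ≡⟨ cong (λ p → endFrom p (N ∷ N ∷ V ++ [ E ])) (sym U-end) ⟩
    endFrom (endpoint U) (N ∷ N ∷ V ++ [ E ])   ≡⟨ sym (endFrom-++ (0 , 0) U (N ∷ N ∷ V ++ [ E ])) ⟩
    endpoint (U ++ N ∷ N ∷ V ++ [ E ])          ≡⟨ UNNVE-end ⟩
    (suc k , h)                                 ∎)
    where open ≡-Reasoning
  open TwinDecomposition U V W U-end V-end

lemma4p3 : ∀ {c ℓ} (R : CommutativeRing c ℓ) (n : ℕ) (P : Path) → IsSchroder n P →
           (x z : ℕ) → 1 ≤ z → (U V W : Path) →
           OneBounceDecomposition P x (z ∸ 1) U N N V E E W →
           (m : ℕ) (q : CommutativeRing.Carrier R) (xs : Fin m → CommutativeRing.Carrier R) →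
           CommutativeRing._≈_ R (lhsSum R m n P x q xs)
             (CommutativeRing._*_ R q (rhsSum R m n P x q xs))
lemma4p3 R n P (P-end , _) x z _ U V W (u₂ , _ , decomposition) m q xs
  with decomposition-twins decomposition
... | k , refl , twins , twins-below-end =
  TwinSums.twin-identity R twins (subst (λ p → suc (suc k) ≤ proj₁ p) P-end twins-below-end) q xs
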